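{- Define $P:\mathbb{Z}_{\ge 0}\to\mathbb{Z}$ by $P(0)=P(1)=P(2)=0$, and for $n\geq 3$, $$P(n)=P\left(\left\lceil \tfrac{n}{2}\right\rceil\right)+P\left(\left\lfloor \tfrac{n}{2}\right\rfloor+1\right)+P\left(\left\lceil \tfrac{n}{2}\right\rceil-1\right)+P\left(\left\lfloor \tfrac{n}{2}\right\rfloor\right)+1.$$ Then for all integers $n\geq 1$ and $1\leq i\leq n$, $$P(n)\leq P(i)+P(n-i+1)+P(i-1)+P(n-i)+1.$$ -}

module Defs where

open import Data.Nat using (ℕ; zero; suc; _+_; _∸_; ⌊_/2⌋; ⌈_/2⌉)
open import Data.Integer using (ℤ; 0ℤ; 1ℤ) renaming (_+_ to _+ℤ_)

-- Fuel-indexed unfolding of the recursion.  For n ≥ 3 every recursive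
-- argument (⌈n/2⌉, ⌊n/2⌋+1, ⌈n/2⌉-1, ⌊n/2⌋) is strictly smaller than n,
-- so fuel n always suffices; P n := Pfuel n n.
Pfuel : ℕ → ℕ → ℤ
Pfuel _ 0 = 0ℤ
Pfuel _ 1 = 0ℤ
Pfuel _ 2 = 0ℤ
Pfuel zero (suc (suc (suc _))) = 0ℤ   -- never reached when fuel ≥ n
Pfuel (suc f) n@(suc (suc (suc _))) =
  Pfuel f ⌈ n /2⌉ +ℤ Pfuel f (suc ⌊ n /2⌋) +ℤ Pfuel f (⌈ n /2⌉ ∸ 1)
    +ℤ Pfuel f ⌊ n /2⌋ +ℤ 1ℤ

P : ℕ → ℤ
P n = Pfuel n n

-- Write Q a = P a + P (a − 1).  The recursion reads P n = Q ⌈n/2⌉ + Q (⌊n/2⌋ + 1) + 1,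
-- and ⌈n/2⌉ + (⌊n/2⌋ + 1) = n + 1, while the claim is P n ≤ Q i + Q j + 1 whenever
-- i + j = n + 1.  So it suffices that Q is convex: then the balanced split minimises
-- Q i + Q j.  The increments of Q are sums of two consecutive increments of P, and the
-- recursion gives ΔP (2k) = ΔQ k and ΔP (2k + 1) = ΔQ (k + 1); hence ΔP is
-- nondecreasing by strong induction, and with it ΔQ.
module Submission where

open import Defs
open import Data.Nat
  using (ℕ; zero; suc; _+_; _∸_; _≤_; _<_; z≤n; s≤s; s≤s⁻¹; ⌊_/2⌋; ⌈_/2⌉; _≤′_; ≤′-refl; ≤′-step)
open import Data.Nat.Properties as ℕ
  using (≤⇒≤′; m≤n⇒∃[o]m+o≡n; n≡⌊n+n/2⌋; n≡⌈n+n/2⌉; ⌊n/2⌋<n; ⌊n/2⌋≤⌈n/2⌉; m∸n≤m)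
open import Data.Nat.Induction using (<-rec)
open import Data.Nat.Tactic.RingSolver as ℕ-Solver using ()
open import Data.Integer using (ℤ; 1ℤ; +≤+) renaming (_+_ to _+ℤ_; _-_ to _-ℤ_; _≤_ to _≤ℤ_)
open import Data.Integer.Properties as ℤ using (+-monoˡ-≤; +-mono-≤; +-inverseʳ; ≤-reflexive)
open import Data.Integer.Tactic.RingSolver using (solve-∀)
open import Data.Product using (_,_)
open import Data.Sum using (inj₁; inj₂)
open import Relation.Binary.PropositionalEquality
  using (_≡_; refl; sym; trans; cong; cong₂; subst)
open ℤ.≤-Reasoning

Δ : (ℕ → ℤ) → ℕ → ℤ
Δ f n = f (suc n) -ℤ f n

m-n≤o-p⇒m+p≤n+o : ∀ m n o p → m -ℤ n ≤ℤ o -ℤ p → m +ℤ p ≤ℤ n +ℤ o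
m-n≤o-p⇒m+p≤n+o m n o p le = begin
  m +ℤ p                    ≡⟨ shift m n p ⟩
  (m -ℤ n) +ℤ (n +ℤ p)      ≤⟨ +-monoˡ-≤ (n +ℤ p) le ⟩
  (o -ℤ p) +ℤ (n +ℤ p)      ≡⟨ unshift o n p ⟩
  n +ℤ o                    ∎
  where
  shift : ∀ x y z → x +ℤ z ≡ (x -ℤ y) +ℤ (y +ℤ z)
  shift = solve-∀
  unshift : ∀ x y z → (x -ℤ z) +ℤ (y +ℤ z) ≡ y +ℤ x
  unshift = solve-∀

step-mono⇒mono : (f : ℕ → ℤ) → (∀ n → f n ≤ℤ f (suc n)) → ∀ {m n} → m ≤ n → f m ≤ℤ f n
step-mono⇒mono f f-step m≤n = go (≤⇒≤′ m≤n)
  where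
  go : ∀ {m n} → m ≤′ n → f m ≤ℤ f n
  go ≤′-refl       = ℤ.≤-refl
  go (≤′-step m≤n) = ℤ.≤-trans (go m≤n) (f-step _)

module Convex (f : ℕ → ℤ) (Δ-mono : ∀ {m n} → m ≤ n → Δ f m ≤ℤ Δ f n) where

  increase-mono : ∀ {a c} → a ≤ c → ∀ d → f (a + d) -ℤ f a ≤ℤ f (c + d) -ℤ f c
  increase-mono {a} {c} a≤c zero = begin
    f (a + 0) -ℤ f a ≡⟨ cong (λ x → f x -ℤ f a) (ℕ.+-identityʳ a) ⟩
    f a -ℤ f a       ≡⟨ trans (+-inverseʳ (f a)) (sym (+-inverseʳ (f c))) ⟩
    f c -ℤ f c       ≡⟨ cong (λ x → f x -ℤ f c) (sym (ℕ.+-identityʳ c)) ⟩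
    f (c + 0) -ℤ f c ∎
  increase-mono {a} {c} a≤c (suc d) = begin
    f (a + suc d) -ℤ f a                  ≡⟨ telescope a ⟩
    Δ f (a + d) +ℤ (f (a + d) -ℤ f a)     ≤⟨ +-mono-≤ (Δ-mono (ℕ.+-monoˡ-≤ d a≤c)) (increase-mono a≤c d) ⟩
    Δ f (c + d) +ℤ (f (c + d) -ℤ f c)     ≡⟨ sym (telescope c) ⟩
    f (c + suc d) -ℤ f c                  ∎
    where
    split : ∀ x y z → x -ℤ z ≡ (x -ℤ y) +ℤ (y -ℤ z)
    split = solve-∀
    telescope : ∀ x → f (x + suc d) -ℤ f x ≡ Δ f (x + d) +ℤ (f (x + d) -ℤ f x)
    telescope x = trans (cong (λ y → f y -ℤ f x) (ℕ.+-suc x d))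
                        (split (f (suc (x + d))) (f (x + d)) (f x))

  balance : ∀ {a c} → a ≤ c → ∀ d → f (a + d) +ℤ f c ≤ℤ f a +ℤ f (c + d)
  balance {a} {c} a≤c d = m-n≤o-p⇒m+p≤n+o (f (a + d)) (f a) (f (c + d)) (f c) (increase-mono a≤c d)

data EvenOrOdd : ℕ → Set where
  even : ∀ k → EvenOrOdd (k + k)
  odd  : ∀ k → EvenOrOdd (suc (k + k))

evenOrOdd : ∀ n → EvenOrOdd n
evenOrOdd zero = even 0
evenOrOdd (suc n) with evenOrOdd n
... | even k = odd k
... | odd k  = subst EvenOrOdd (cong suc (ℕ.+-suc k k)) (even (suc k))

recurrence : (ℕ → ℤ) → ℕ → ℤ
recurrence p n = p ⌈ n /2⌉ +ℤ p (suc ⌊ n /2⌋) +ℤ p (⌈ n /2⌉ ∸ 1) +ℤ p ⌊ n /2⌋ +ℤ 1ℤ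

recurrence-cong : ∀ {p q} n → (∀ {a} → a ≤ suc ⌊ n /2⌋ → p a ≡ q a) → recurrence p n ≡ recurrence q n
recurrence-cong n p≗q =
  cong (_+ℤ 1ℤ) (cong₂ _+ℤ_ (cong₂ _+ℤ_ (cong₂ _+ℤ_ (p≗q ⌈n/2⌉≤) (p≗q ℕ.≤-refl))
                                         (p≗q (ℕ.≤-trans (m∸n≤m _ 1) ⌈n/2⌉≤)))
                            (p≗q (ℕ.n≤1+n _)))
  where
  ⌈n/2⌉≤ : ⌈ n /2⌉ ≤ suc ⌊ n /2⌋
  ⌈n/2⌉≤ = ⌊n/2⌋≤⌈n/2⌉ (suc n)

suc⌊n/2⌋<n : ∀ {n} → 3 ≤ n → suc ⌊ n /2⌋ < n
suc⌊n/2⌋<n {suc (suc (suc m))} _ = s≤s (s≤s (⌊n/2⌋<n m))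
suc⌊n/2⌋<n {1} (s≤s ())
suc⌊n/2⌋<n {2} (s≤s (s≤s ()))

Pfuel-irrelevant : ∀ {f g} n → n ≤ f → n ≤ g → Pfuel f n ≡ Pfuel g n
Pfuel-irrelevant 0 _ _ = refl
Pfuel-irrelevant 1 _ _ = refl
Pfuel-irrelevant 2 _ _ = refl
Pfuel-irrelevant {suc f} {suc g} n@(suc (suc (suc _))) n≤f n≤g = recurrence-cong n same
  where
  below : ∀ {a h} → a ≤ suc ⌊ n /2⌋ → n ≤ suc h → a ≤ h
  below a≤ n≤ = s≤s⁻¹ (ℕ.≤-trans (s≤s a≤) (ℕ.≤-trans (suc⌊n/2⌋<n (s≤s (s≤s (s≤s z≤n)))) n≤))
  same : ∀ {a} → a ≤ suc ⌊ n /2⌋ → Pfuel f a ≡ Pfuel g a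
  same a≤ = Pfuel-irrelevant _ (below a≤ n≤f) (below a≤ n≤g)

P-recurrence : ∀ n → 3 ≤ n → P n ≡ recurrence P n
P-recurrence 1 (s≤s ())
P-recurrence 2 (s≤s (s≤s ()))
P-recurrence n@(suc (suc (suc m))) 3≤n = recurrence-cong n λ a≤ → Pfuel-irrelevant _ (below a≤) ℕ.≤-refl
  where
  below : ∀ {a} → a ≤ suc ⌊ n /2⌋ → a ≤ suc (suc m)
  below a≤ = s≤s⁻¹ (ℕ.≤-trans (s≤s a≤) (suc⌊n/2⌋<n 3≤n))

Q : ℕ → ℤ
Q a = P a +ℤ P (a ∸ 1)

P-unfold : ∀ n → 3 ≤ n → P n ≡ Q ⌈ n /2⌉ +ℤ Q (suc ⌊ n /2⌋) +ℤ 1ℤ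
P-unfold n 3≤n = trans (P-recurrence n 3≤n)
  (regroup (P ⌈ n /2⌉) (P (suc ⌊ n /2⌋)) (P (⌈ n /2⌉ ∸ 1)) (P ⌊ n /2⌋))
  where
  regroup : ∀ a b c d → a +ℤ b +ℤ c +ℤ d +ℤ 1ℤ ≡ (a +ℤ c) +ℤ (b +ℤ d) +ℤ 1ℤ
  regroup = solve-∀

P-even : ∀ k → 2 ≤ k → P (k + k) ≡ Q k +ℤ Q (suc k) +ℤ 1ℤ
P-even k 2≤k = trans (P-unfold (k + k) (ℕ.+-mono-≤ (ℕ.<⇒≤ 2≤k) 2≤k))
  (cong₂ (λ c f → Q c +ℤ Q (suc f) +ℤ 1ℤ) (sym (n≡⌈n+n/2⌉ k)) (sym (n≡⌊n+n/2⌋ k)))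

P-odd : ∀ k → 1 ≤ k → P (suc (k + k)) ≡ Q (suc k) +ℤ Q (suc k) +ℤ 1ℤ
P-odd k 1≤k = trans (P-unfold (suc (k + k)) (s≤s (ℕ.+-mono-≤ 1≤k 1≤k)))
  (cong₂ (λ c f → Q (suc c) +ℤ Q (suc f) +ℤ 1ℤ) (sym (n≡⌊n+n/2⌋ k)) (sym (n≡⌈n+n/2⌉ k)))

P-even-≤ : ∀ k → P (k + k) ≤ℤ Q k +ℤ Q (suc k) +ℤ 1ℤ
P-even-≤ 0 = +≤+ z≤n
P-even-≤ 1 = +≤+ z≤n
P-even-≤ k@(suc (suc _)) = ≤-reflexive (P-even k (s≤s (s≤s z≤n)))

P-odd-≤ : ∀ k → P (suc (k + k)) ≤ℤ Q (suc k) +ℤ Q (suc k) +ℤ 1ℤ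
P-odd-≤ 0 = +≤+ z≤n
P-odd-≤ k@(suc _) = ≤-reflexive (P-odd k (s≤s z≤n))

ΔQ-suc : ∀ a → Δ Q (suc a) ≡ Δ P (suc a) +ℤ Δ P a
ΔQ-suc a = telescope (P (suc (suc a))) (P (suc a)) (P a)
  where
  telescope : ∀ x y z → (x +ℤ y) -ℤ (y +ℤ z) ≡ (x -ℤ y) +ℤ (y -ℤ z)
  telescope = solve-∀

ΔQ-suc-step : ∀ a → Δ P a ≤ℤ Δ P (suc a) → Δ P (suc a) ≤ℤ Δ P (suc (suc a)) →
  Δ Q (suc a) ≤ℤ Δ Q (suc (suc a))
ΔQ-suc-step a ΔPa≤ ΔPsa≤ = begin
  Δ Q (suc a)                         ≡⟨ ΔQ-suc a ⟩
  Δ P (suc a) +ℤ Δ P a                ≤⟨ +-mono-≤ ΔPsa≤ ΔPa≤ ⟩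
  Δ P (suc (suc a)) +ℤ Δ P (suc a)    ≡⟨ sym (ΔQ-suc (suc a)) ⟩
  Δ Q (suc (suc a))                   ∎

ΔP-even : ∀ k → 2 ≤ k → Δ P (k + k) ≡ Δ Q k
ΔP-even k 2≤k =
  trans (cong₂ _-ℤ_ (P-odd k (ℕ.<⇒≤ 2≤k)) (P-even k 2≤k)) (cancel (Q (suc k)) (Q k))
  where
  cancel : ∀ x y → (x +ℤ x +ℤ 1ℤ) -ℤ (y +ℤ x +ℤ 1ℤ) ≡ x -ℤ y
  cancel = solve-∀

ΔP-odd : ∀ k → 1 ≤ k → Δ P (suc (k + k)) ≡ Δ Q (suc k)
ΔP-odd k 1≤k = begin-equality
  P (suc (suc (k + k))) -ℤ P (suc (k + k))  ≡⟨ cong (λ n → P n -ℤ P (suc (k + k))) (cong suc (sym (ℕ.+-suc k k))) ⟩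
  P (suc k + suc k) -ℤ P (suc (k + k))      ≡⟨ cong₂ _-ℤ_ (P-even (suc k) (s≤s 1≤k)) (P-odd k 1≤k) ⟩
  (Q (suc k) +ℤ Q (suc (suc k)) +ℤ 1ℤ) -ℤ (Q (suc k) +ℤ Q (suc k) +ℤ 1ℤ)
                                            ≡⟨ cancel (Q (suc k)) (Q (suc (suc k))) ⟩
  Δ Q (suc k)                               ∎
  where
  cancel : ∀ x y → (x +ℤ y +ℤ 1ℤ) -ℤ (x +ℤ x +ℤ 1ℤ) ≡ y -ℤ x
  cancel = solve-∀

ΔP-step-mono : ∀ m → Δ P m ≤ℤ Δ P (suc m)
ΔP-step-mono = <-rec _ step
  where
  step : ∀ m → (∀ {x} → x < m → Δ P x ≤ℤ Δ P (suc x)) → Δ P m ≤ℤ Δ P (suc m)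
  step m ih with evenOrOdd m
  ... | even 0 = ℤ.≤-refl
  ... | odd 0  = +≤+ z≤n
  ... | even 1 = ℤ.≤-refl
  ... | even k@(suc j@(suc _)) = begin
    Δ P (k + k)       ≡⟨ ΔP-even k (s≤s (s≤s z≤n)) ⟩
    Δ Q k             ≤⟨ ΔQ-suc-step j (ih j<k+k) (ih k<k+k) ⟩
    Δ Q (suc k)       ≡⟨ sym (ΔP-odd k (s≤s z≤n)) ⟩
    Δ P (suc (k + k)) ∎
    where
    k<k+k : k < k + k
    k<k+k = ℕ.m<m+n k (s≤s z≤n)
    j<k+k : j < k + k
    j<k+k = ℕ.≤-trans (ℕ.n≤1+n k) k<k+k
  ... | odd k@(suc _) = begin
    Δ P (suc (k + k))       ≡⟨ ΔP-odd k (s≤s z≤n) ⟩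
    Δ Q (suc k)             ≡⟨ sym (ΔP-even (suc k) (s≤s (s≤s z≤n))) ⟩
    Δ P (suc k + suc k)     ≡⟨ cong (Δ P) (cong suc (ℕ.+-suc k k)) ⟩
    Δ P (suc (suc (k + k))) ∎

ΔQ-step-mono : ∀ a → Δ Q a ≤ℤ Δ Q (suc a)
ΔQ-step-mono zero    = ℤ.≤-refl
ΔQ-step-mono (suc a) = ΔQ-suc-step a (ΔP-step-mono a) (ΔP-step-mono (suc a))

open Convex Q (step-mono⇒mono (Δ Q) ΔQ-step-mono) using (balance)

P≤Q[i]+Q[i+e]+1 : ∀ {n} i e → 1 ≤ i → i + (i + e) ≡ suc n → P n ≤ℤ Q i +ℤ Q (i + e) +ℤ 1ℤ
P≤Q[i]+Q[i+e]+1 {n} i e 1≤i i+i+e≡ with evenOrOdd e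
P≤Q[i]+Q[i+e]+1 {n} i@(suc j) .(d + d) _ i+i+e≡ | even d = begin
  P n                           ≡⟨ cong P n≡ ⟩
  P (suc (k + k))               ≤⟨ P-odd-≤ k ⟩
  Q (i + d) +ℤ Q (i + d) +ℤ 1ℤ  ≤⟨ +-monoˡ-≤ 1ℤ (balance (ℕ.m≤m+n i d) d) ⟩
  Q i +ℤ Q (i + d + d) +ℤ 1ℤ    ≡⟨ cong (λ b → Q i +ℤ Q b +ℤ 1ℤ) (ℕ.+-assoc i d d) ⟩
  Q i +ℤ Q (i + (d + d)) +ℤ 1ℤ  ∎
  where
  k : ℕ
  k = j + d
  sum : ∀ j d → j + suc (j + (d + d)) ≡ suc ((j + d) + (j + d))
  sum = ℕ-Solver.solve-∀
  n≡ : n ≡ suc (k + k)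
  n≡ = ℕ.suc-injective (trans (sym i+i+e≡) (cong suc (sum j d)))
P≤Q[i]+Q[i+e]+1 {n} i .(suc (d + d)) _ i+i+e≡ | odd d = begin
  P n                                 ≡⟨ cong P n≡ ⟩
  P (k + k)                           ≤⟨ P-even-≤ k ⟩
  Q (i + d) +ℤ Q (suc (i + d)) +ℤ 1ℤ  ≤⟨ +-monoˡ-≤ 1ℤ (balance (ℕ.m≤n⇒m≤1+n (ℕ.m≤m+n i d)) d) ⟩
  Q i +ℤ Q (suc (i + d) + d) +ℤ 1ℤ    ≡⟨ cong (λ b → Q i +ℤ Q b +ℤ 1ℤ) (sym (lean i d)) ⟩
  Q i +ℤ Q (i + suc (d + d)) +ℤ 1ℤ    ∎
  where
  k : ℕ
  k = i + d
  sum : ∀ i d → i + (i + suc (d + d)) ≡ suc ((i + d) + (i + d))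
  sum = ℕ-Solver.solve-∀
  lean : ∀ i d → i + suc (d + d) ≡ suc (i + d) + d
  lean = ℕ-Solver.solve-∀
  n≡ : n ≡ k + k
  n≡ = ℕ.suc-injective (trans (sym i+i+e≡) (sum i d))

P≤Q[i]+Q[b]+1 : ∀ {n} i b → 1 ≤ i → 1 ≤ b → i + b ≡ suc n → P n ≤ℤ Q i +ℤ Q b +ℤ 1ℤ
P≤Q[i]+Q[b]+1 i b 1≤i 1≤b i+b≡ with ℕ.≤-total i b
... | inj₁ i≤b with m≤n⇒∃[o]m+o≡n i≤b
...   | e , refl = P≤Q[i]+Q[i+e]+1 i e 1≤i i+b≡
P≤Q[i]+Q[b]+1 {n} i b 1≤i 1≤b i+b≡ | inj₂ b≤i with m≤n⇒∃[o]m+o≡n b≤i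
...   | e , refl = begin
  P n                      ≤⟨ P≤Q[i]+Q[i+e]+1 b e 1≤b (trans (ℕ.+-comm b i) i+b≡) ⟩
  Q b +ℤ Q (b + e) +ℤ 1ℤ   ≡⟨ cong (_+ℤ 1ℤ) (ℤ.+-comm (Q b) (Q (b + e))) ⟩
  Q (b + e) +ℤ Q b +ℤ 1ℤ   ∎

lemma2 : (n i : ℕ) → 1 ≤ n → 1 ≤ i → i ≤ n →
    P n ≤ℤ P i +ℤ P (n ∸ i + 1) +ℤ P (i ∸ 1) +ℤ P (n ∸ i) +ℤ 1ℤ
lemma2 n i _ 1≤i i≤n = begin
  P n                                         ≤⟨ P≤Q[i]+Q[b]+1 i b 1≤i (ℕ.m≤n+m 1 (n ∸ i)) i+b≡ ⟩
  Q i +ℤ Q b +ℤ 1ℤ                            ≡⟨ regroup (P i) (P b) (P (i ∸ 1)) (P (b ∸ 1)) ⟩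
  P i +ℤ P b +ℤ P (i ∸ 1) +ℤ P (b ∸ 1) +ℤ 1ℤ
    ≡⟨ cong (λ x → P i +ℤ P b +ℤ P (i ∸ 1) +ℤ P x +ℤ 1ℤ) (ℕ.m+n∸n≡m (n ∸ i) 1) ⟩
  P i +ℤ P b +ℤ P (i ∸ 1) +ℤ P (n ∸ i) +ℤ 1ℤ  ∎
  where
  b : ℕ
  b = n ∸ i + 1
  i+b≡ : i + b ≡ suc n
  i+b≡ = trans (cong (i +_) (ℕ.+-comm (n ∸ i) 1))
           (trans (ℕ.+-suc i (n ∸ i)) (cong suc (ℕ.m+[n∸m]≡n i≤n)))
  regroup : ∀ a b c d → (a +ℤ c) +ℤ (b +ℤ d) +ℤ 1ℤ ≡ a +ℤ b +ℤ c +ℤ d +ℤ 1ℤ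
  regroup = solve-∀
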